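{- Any non-adaptive algorithm that reconstructs an unrooted binary (phylogenetic) tree on $n$ leaves, even without noise, requires $\Omega(n^3)$ quartet queries.
   Context: A phylogenetic (unrooted binary) tree on a set of $n$ labeled leaves is an unrooted tree whose leaves are bijectively labeled and whose internal vertices have degree $3$. A quartet query specifies a 4-element set $\{a,b,c,d\}$ of leaves and returns the unique quartet among $ab|cd$, $ac|bd$, $ad|bc$ satisfied by the unknown tree, where $ab|cd$ is satisfied if the $a$–$b$ path and the $c$–$d$ path are vertex-disjoint. An algorithm is non-adaptive if its set of queries is chosen without depending on the answers to previous queries. Without noise, every answer is correct; reconstruction means exactly recovering the tree. -}

module Defs where

open import Data.Nat using (ℕ; suc; _+_; _*_; _^_; _≤_)
open import Data.Bool using (Bool; true; false; if_then_else_)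
open import Data.Fin using (Fin)
open import Data.Fin.Subset using (Subset; ∣_∣) renaming (_∈_ to _∈ₛ_)
open import Data.List using (List; []; _∷_; map; allFin; length)
open import Data.Nat.ListAction using (sum)
open import Data.List.Membership.Propositional using (_∈_)
open import Data.List.Relation.Unary.Unique.Propositional using (Unique)
open import Data.Product using (Σ; ∃; ∃-syntax; _×_; _,_)
open import Function.Bundles using (_↔_; Inverse; _⇔_)
open import Relation.Binary.PropositionalEquality using (_≡_)
open import Relation.Nullary using (¬_)

data Walk {V : ℕ} (adj : Fin V → Fin V → Bool) : Fin V → Fin V → List (Fin V) → Set where
  here : ∀ {u} → Walk adj u u (u ∷ [])
  step : ∀ {u w v p} → adj u w ≡ true → Walk adj w v p → Walk adj u v (u ∷ p)

Path : {V : ℕ} → (Fin V → Fin V → Bool) → Fin V → Fin V → List (Fin V) → Set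
Path adj u v p = Walk adj u v p × Unique p

degree : {V : ℕ} → (Fin V → Fin V → Bool) → Fin V → ℕ
degree {V} adj v = sum (map (λ w → if adj v w then 1 else 0) (allFin V))

record PhyloTree (n : ℕ) : Set where
  field
    V       : ℕ
    adj     : Fin V → Fin V → Bool
    adj-sym : ∀ u v → adj u v ≡ adj v u
    adj-irr : ∀ v → adj v v ≡ false
    connected  : ∀ u v → ∃[ p ] Path adj u v p
    uniquePath : ∀ u v p q → Path adj u v p → Path adj u v q → p ≡ q
    leaf       : Fin n → Fin V
    leaf-inj   : ∀ i j → leaf i ≡ leaf j → i ≡ j
    leaf-deg   : ∀ i → degree adj (leaf i) ≡ 1
    inner-deg  : ∀ v → (∀ i → ¬ leaf i ≡ v) → degree adj v ≡ 3

open PhyloTree public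

Satisfies : {n : ℕ} → PhyloTree n → Fin n → Fin n → Fin n → Fin n → Set
Satisfies T a b c d =
  ∃[ p ] ∃[ q ] (Path (adj T) (leaf T a) (leaf T b) p × Path (adj T) (leaf T c) (leaf T d) q
                 × (∀ x → x ∈ p → ¬ x ∈ q))

_≅_ : {n : ℕ} → PhyloTree n → PhyloTree n → Set
T₁ ≅ T₂ = Σ (Fin (V T₁) ↔ Fin (V T₂)) λ f →
  (∀ u v → adj T₁ u v ≡ adj T₂ (Inverse.to f u) (Inverse.to f v)) ×
  (∀ i → Inverse.to f (leaf T₁ i) ≡ leaf T₂ i)

IsQuery : {n : ℕ} → Subset n → Set
IsQuery q = ∣ q ∣ ≡ 4

SameAnswer : {n : ℕ} → PhyloTree n → PhyloTree n → Subset n → Set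
SameAnswer T₁ T₂ q = ∀ a b c d → a ∈ₛ q → b ∈ₛ q → c ∈ₛ q → d ∈ₛ q →
  ¬ a ≡ b → ¬ a ≡ c → ¬ a ≡ d → ¬ b ≡ c → ¬ b ≡ d → ¬ c ≡ d →
  (Satisfies T₁ a b c d ⇔ Satisfies T₂ a b c d)

-- A non-adaptive (noiseless) algorithm is a fixed list of distinct queries;
-- it reconstructs the tree iff the answers to those queries determine the
-- tree up to labelled-tree equality.
Reconstructs : {n : ℕ} → List (Subset n) → Set
Reconstructs {n} Q = ∀ (T₁ T₂ : PhyloTree n) → (∀ q → q ∈ Q → SameAnswer T₁ T₂ q) → T₁ ≅ T₂

ValidQueries : {n : ℕ} → List (Subset n) → Set
ValidQueries Q = Unique Q × (∀ q → q ∈ Q → IsQuery q)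

-- If some three leaves a, b, c lie together in no query, take the caterpillar whose leaves read
-- a, b, c, … along the spine and the same caterpillar with b and c exchanged.  They are different
-- trees, since only the first has {a, b} as a cherry.  Yet they answer every query alike: on a
-- caterpillar ab|cd holds iff the positions of {a, b} and {c, d} are separated, and exchanging
-- positions 1 and 2 preserves separation unless positions 0, 1 and 2 (that is, a, b and c) all
-- occur.  So the queries cover all C(n,3) triples; a query contains four triples, whence
-- 4·|Q| ≥ C(n,3) ≥ n³/12 for n ≥ 6.

module Submission where

open import Defs
open import Data.Nat using (ℕ; suc; _*_; _^_; _≤_)
open import Data.List using (List; length)
open import Data.Fin.Subset using (Subset)
open import Data.Product using (∃; ∃-syntax; _×_; _,_)
open import Data.Fin using (Fin)
open import Data.Bool using (Bool)

module Binomial where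

  open import Data.Nat using (zero; _+_; z≤n; s≤s)
  open import Data.Nat.Properties using (*-assoc; *-distribˡ-+; m≤m+n; module ≤-Reasoning)
  open import Data.Nat.Combinatorics using (_C_; nC1≡n; nCk+nC[k+1]≡[n+1]C[k+1])
  open import Data.Nat.Tactic.RingSolver using (solve)
  open import Data.List using ([]; _∷_)
  open import Relation.Binary.PropositionalEquality using (_≡_; refl; sym; cong; cong₂; module ≡-Reasoning)

  2*[1+n]C2≡[1+n]*n : ∀ n → 2 * (suc n C 2) ≡ suc n * n
  2*[1+n]C2≡[1+n]*n zero    = refl
  2*[1+n]C2≡[1+n]*n (suc n) = begin
    2 * (suc (suc n) C 2)              ≡⟨ cong (2 *_) (sym (nCk+nC[k+1]≡[n+1]C[k+1] (suc n) 1)) ⟩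
    2 * (suc n C 1 + suc n C 2)        ≡⟨ *-distribˡ-+ 2 (suc n C 1) _ ⟩
    2 * (suc n C 1) + 2 * (suc n C 2)  ≡⟨ cong₂ (λ a b → 2 * a + b) (nC1≡n (suc n)) (2*[1+n]C2≡[1+n]*n n) ⟩
    2 * suc n + suc n * n              ≡⟨ solve (n ∷ []) ⟩
    suc (suc n) * suc n                ∎
    where open ≡-Reasoning

  6*[2+n]C3≡[2+n]*[1+n]*n : ∀ n → 6 * ((2 + n) C 3) ≡ (2 + n) * (1 + n) * n
  6*[2+n]C3≡[2+n]*[1+n]*n zero    = refl
  6*[2+n]C3≡[2+n]*[1+n]*n (suc n) = begin
    6 * ((3 + n) C 3)                                ≡⟨ cong (6 *_) (sym (nCk+nC[k+1]≡[n+1]C[k+1] (2 + n) 2)) ⟩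
    6 * ((2 + n) C 2 + (2 + n) C 3)                  ≡⟨ *-distribˡ-+ 6 ((2 + n) C 2) _ ⟩
    6 * ((2 + n) C 2) + 6 * ((2 + n) C 3)            ≡⟨ cong (_+ 6 * ((2 + n) C 3)) (*-assoc 3 2 ((2 + n) C 2)) ⟩
    3 * (2 * ((2 + n) C 2)) + 6 * ((2 + n) C 3)      ≡⟨ cong₂ (λ a b → 3 * a + b) (2*[1+n]C2≡[1+n]*n (suc n))
                                                                                  (6*[2+n]C3≡[2+n]*[1+n]*n n) ⟩
    3 * ((2 + n) * (1 + n)) + (2 + n) * (1 + n) * n  ≡⟨ solve (n ∷ []) ⟩
    (3 + n) * (2 + n) * (1 + n)                      ∎
    where open ≡-Reasoning

  n³≤12*nC3 : ∀ {n} → 6 ≤ n → n ^ 3 ≤ 12 * (n C 3)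
  n³≤12*nC3 (s≤s (s≤s (s≤s (s≤s (s≤s (s≤s {n = m} z≤n)))))) = begin
    (6 + m) ^ 3
      ≤⟨ m≤m+n _ (m * m * m + 12 * (m * m) + 40 * m + 24) ⟩
    (6 + m) * ((6 + m) * ((6 + m) * 1)) + (m * m * m + 12 * (m * m) + 40 * m + 24)
      ≡⟨ solve (m ∷ []) ⟩
    2 * ((6 + m) * (5 + m) * (4 + m))
      ≡⟨ cong (2 *_) (sym (6*[2+n]C3≡[2+n]*[1+n]*n (4 + m))) ⟩
    2 * (6 * ((6 + m) C 3))
      ≡⟨ sym (*-assoc 2 6 ((6 + m) C 3)) ⟩
    12 * ((6 + m) C 3)
      ∎
    where open ≤-Reasoning

module Covering where

  open import Data.Nat using (zero; _+_; z≤n; s≤s)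
  open import Data.Nat.Properties using (+-commutativeSemigroup; +-mono-≤; *-suc; module ≤-Reasoning)
  open import Algebra.Properties.CommutativeSemigroup +-commutativeSemigroup using (interchange; x∙yz≈y∙xz)
  open import Data.Nat.Combinatorics using (_C_; nCk+nC[k+1]≡[n+1]C[k+1])
  open import Data.Nat.ListAction using (sum)
  open import Data.Fin using (Fin; zero; suc)
  open import Data.Fin.Properties using (suc-injective)
  open import Data.Fin.Subset using (∣_∣; inside; outside) renaming (_∈_ to _∈ₛ_)
  open import Data.Fin.Subset.Properties using (drop-there)
  open import Data.Vec as Vec using (Vec; []; _∷_; tail)
  open import Data.Vec.Relation.Unary.All as All using (All; []; _∷_)
  import Data.Vec.Relation.Unary.All.Properties as All
  open import Data.Vec.Relation.Unary.AllPairs using ([]; _∷_)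
  open import Data.Vec.Relation.Unary.Unique.Propositional using (Unique)
  open import Data.Vec.Relation.Unary.Unique.Propositional.Properties using () renaming (map⁺ to unique-map⁺)
  open import Data.List using ([]; _∷_; map)
  open import Data.List.Membership.Propositional using (_∈_)
  open import Data.List.Relation.Unary.Any as Any using (Any; here; there)
  open import Data.List.Relation.Unary.Any.Properties using () renaming (map⁺ to any-map⁺)
  open import Function using (_∘_)
  open import Relation.Binary.PropositionalEquality using (_≡_; refl; sym; cong; cong₂; module ≡-Reasoning)

  private variable n k : ℕ

  Covers : ℕ → List (Subset n) → Set
  Covers {n} k Q = (v : Vec (Fin n) k) → Unique v → Any (λ q → All (_∈ₛ q) v) Q

  link : List (Subset (suc n)) → List (Subset n)
  link []                  = []
  link ((inside  ∷ q) ∷ Q) = q ∷ link Q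
  link ((outside ∷ q) ∷ Q) = link Q

  deletion : List (Subset (suc n)) → List (Subset n)
  deletion = map tail

  weight : ℕ → List (Subset n) → ℕ
  weight k Q = sum (map (λ q → ∣ q ∣ C k) Q)

  covers-link : (Q : List (Subset (suc n))) → Covers (suc k) Q → Covers k (link Q)
  covers-link Q cov v !v =
    restrict Q (cov (zero ∷ Vec.map suc v) (All.map⁺ (All.universal (λ _ ()) v) ∷ unique-map⁺ suc-injective !v))
    where
    restrict : ∀ Q → Any (λ q → All (_∈ₛ q) (zero ∷ Vec.map suc v)) Q → Any (λ q → All (_∈ₛ q) v) (link Q)
    restrict ((inside  ∷ q) ∷ Q) (here (_ ∷ v⊆q)) = here (All.map drop-there (All.map⁻ v⊆q))
    restrict ((inside  ∷ q) ∷ Q) (there h)        = there (restrict Q h)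
    restrict ((outside ∷ q) ∷ Q) (here (() ∷ _))
    restrict ((outside ∷ q) ∷ Q) (there h)        = restrict Q h

  covers-deletion : (Q : List (Subset (suc n))) → Covers k Q → Covers k (deletion Q)
  covers-deletion Q cov v !v =
    any-map⁺ (Any.map (λ { {_ ∷ q} sv⊆q → All.map drop-there (All.map⁻ sv⊆q) })
                      (cov (Vec.map suc v) (unique-map⁺ suc-injective !v)))

  weight-split : (Q : List (Subset (suc n))) → weight (suc k) Q ≡ weight k (link Q) + weight (suc k) (deletion Q)
  weight-split [] = refl
  weight-split {k = k} ((inside ∷ q) ∷ Q) = begin
    suc ∣ q ∣ C suc k + weight (suc k) Q
      ≡⟨ cong₂ _+_ (sym (nCk+nC[k+1]≡[n+1]C[k+1] ∣ q ∣ k)) (weight-split Q) ⟩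
    (∣ q ∣ C k + ∣ q ∣ C suc k) + (weight k (link Q) + weight (suc k) (deletion Q))
      ≡⟨ interchange (∣ q ∣ C k) _ _ _ ⟩
    (∣ q ∣ C k + weight k (link Q)) + (∣ q ∣ C suc k + weight (suc k) (deletion Q)) ∎
    where open ≡-Reasoning
  weight-split {k = k} ((outside ∷ q) ∷ Q) = begin
    ∣ q ∣ C suc k + weight (suc k) Q
      ≡⟨ cong (∣ q ∣ C suc k +_) (weight-split Q) ⟩
    ∣ q ∣ C suc k + (weight k (link Q) + weight (suc k) (deletion Q))
      ≡⟨ x∙yz≈y∙xz (∣ q ∣ C suc k) (weight k (link Q)) _ ⟩
    weight k (link Q) + (∣ q ∣ C suc k + weight (suc k) (deletion Q)) ∎
    where open ≡-Reasoning

  covering-bound : ∀ n k (Q : List (Subset n)) → Covers k Q → n C k ≤ weight k Q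
  covering-bound n zero Q cov with cov [] []
  ... | here _  = s≤s z≤n
  ... | there _ = s≤s z≤n
  covering-bound zero (suc k) Q cov = z≤n
  covering-bound (suc n) (suc k) Q cov = begin
    suc n C suc k
      ≡⟨ sym (nCk+nC[k+1]≡[n+1]C[k+1] n k) ⟩
    n C k + n C suc k
      ≤⟨ +-mono-≤ (covering-bound n k (link Q) (covers-link Q cov))
                  (covering-bound n (suc k) (deletion Q) (covers-deletion Q cov)) ⟩
    weight k (link Q) + weight (suc k) (deletion Q)
      ≡⟨ sym (weight-split Q) ⟩
    weight (suc k) Q
      ∎
    where open ≤-Reasoning

  weight-of-quadruples : (Q : List (Subset n)) → (∀ q → q ∈ Q → ∣ q ∣ ≡ 4) → weight 3 Q ≡ 4 * length Q
  weight-of-quadruples [] _ = refl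
  weight-of-quadruples (q ∷ Q) ∣Q∣≡4 = begin
    ∣ q ∣ C 3 + weight 3 Q   ≡⟨ cong₂ (λ a b → a C 3 + b) (∣Q∣≡4 q (here refl))
                                      (weight-of-quadruples Q (λ q′ → ∣Q∣≡4 q′ ∘ there)) ⟩
    4 + 4 * length Q         ≡⟨ sym (*-suc 4 (length Q)) ⟩
    4 * length (q ∷ Q)       ∎
    where open ≡-Reasoning

module WalkProperties {V : ℕ} (adj : Fin V → Fin V → Bool) where

  open import Data.Bool using (true)
  open import Data.Fin using (_≟_)
  open import Data.List using ([]; _∷_; _++_)
  open import Data.List.Membership.Propositional using (_∈_; _∉_)
  open import Data.List.Membership.Propositional.Properties using (∈-++⁻)
  open import Data.List.Membership.DecPropositional (_≟_ {V}) using (_∈?_)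
  open import Data.List.Relation.Binary.Subset.Propositional using (_⊆_)
  open import Data.List.Relation.Binary.Subset.Propositional.Properties
    using (⊆-refl; ⊆-trans; xs⊆ys++xs; xs⊆x∷xs; ∷⁺ʳ)
  open import Data.List.Relation.Unary.Any using (here; there)
  open import Data.List.Relation.Unary.All using ([])
  open import Data.List.Relation.Unary.All.Properties using (All¬⇒¬Any; ¬Any⇒All¬)
  open import Data.List.Relation.Unary.AllPairs as AllPairs using (_∷_)
  open import Data.List.Relation.Unary.Unique.Propositional using (Unique)
  open import Data.Sum using (inj₁; inj₂)
  open import Data.Empty using (⊥-elim)
  open import Function using (_∘_)
  open import Relation.Binary.PropositionalEquality using (_≡_; _≢_; refl; trans; cong)
  open import Relation.Nullary using (yes; no)

  private variable
    u v w x y : Fin V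
    p q : List (Fin V)

  WalkWithin : Fin V → Fin V → List (Fin V) → Set
  WalkWithin u v p = ∃[ r ] Walk adj u v r × r ⊆ p

  PathWithin : Fin V → Fin V → List (Fin V) → Set
  PathWithin u v p = ∃[ r ] Path adj u v r × r ⊆ p

  start∈ : Walk adj u v p → u ∈ p
  start∈ here       = here refl
  start∈ (step _ _) = here refl

  end∈ : Walk adj u v p → v ∈ p
  end∈ here          = here refl
  end∈ (step _ walk) = there (end∈ walk)

  walk-++ : Walk adj u v p → Walk adj v w q → WalkWithin u w (p ++ q)
  walk-++ here           walk₂ = _ , walk₂ , xs⊆ys++xs _ _
  walk-++ (step e walk₁) walk₂ with walk-++ walk₁ walk₂
  ... | r , walk , r⊆ = _ , step e walk , ∷⁺ʳ _ r⊆

  walk-reverse : (∀ u v → adj u v ≡ adj v u) → Walk adj u v p → WalkWithin v u p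
  walk-reverse adj-sym here = _ , here , ⊆-refl
  walk-reverse adj-sym (step {u} {x} e walk) with walk-reverse adj-sym walk
  ... | r , back , r⊆ with walk-++ back (step (trans (adj-sym x u) e) here)
  ... | r′ , back′ , r′⊆ = r′ , back′ , ⊆-trans r′⊆ within
    where
    within : r ++ x ∷ u ∷ [] ⊆ u ∷ _
    within m with ∈-++⁻ r m
    ... | inj₁ m′                  = there (r⊆ m′)
    ... | inj₂ (here refl)         = there (start∈ walk)
    ... | inj₂ (there (here refl)) = here refl

  path-suffix : Walk adj x v q → Unique q → u ∈ q → PathWithin u v q
  path-suffix here            !q       (here refl) = _ , (here , !q) , ⊆-refl
  path-suffix walk@(step _ _) !q       (here refl) = _ , (walk , !q) , ⊆-refl
  path-suffix here            _        (there ())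
  path-suffix (step _ walk)   (_ ∷ !q) (there m) with path-suffix walk !q m
  ... | r , path , r⊆ = r , path , ⊆-trans r⊆ (xs⊆x∷xs _ _)

  walk⇒path : Walk adj u v p → PathWithin u v p
  walk⇒path here = _ , (here , [] ∷ AllPairs.[]) , ⊆-refl
  walk⇒path {u} (step e walk) with walk⇒path walk
  ... | r , (path , !r) , r⊆ with u ∈? r
  ... | yes u∈r = let r′ , path′ , r′⊆ = path-suffix path !r u∈r
                  in  r′ , path′ , ⊆-trans (⊆-trans r′⊆ r⊆) (xs⊆x∷xs _ _)
  ... | no  u∉r = u ∷ r , (step e path , ¬Any⇒All¬ r u∉r ∷ !r) , ∷⁺ʳ u r⊆

  avoiding-invariant : (P : Fin V → Set) → (∀ {y y′} → P y → adj y y′ ≡ true → y′ ≢ u → P y′) →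
                       Walk adj x v p → u ∉ p → P x → P v
  avoiding-invariant P P-step here          u∉p Px = Px
  avoiding-invariant P P-step (step e walk) u∉p Px =
    avoiding-invariant P P-step walk (u∉p ∘ there) (P-step Px e λ { refl → u∉p (there (start∈ walk)) })

  walk-from-pendant : (∀ {y} → adj x y ≡ true → y ≡ u) → Walk adj x v p → u ∉ p → v ≡ x
  walk-from-pendant only-u walk u∉p =
    avoiding-invariant (_≡ _) (λ { refl e y′≢u → ⊥-elim (y′≢u (only-u e)) }) walk u∉p refl

  walk-to-pendant : (∀ u v → adj u v ≡ adj v u) → (∀ {y} → adj x y ≡ true → y ≡ u) →
                    Walk adj y x q → u ∉ q → y ≡ x
  walk-to-pendant adj-sym only-u walk u∉q with walk-reverse adj-sym walk
  ... | _ , back , r⊆q = walk-from-pendant only-u back (u∉q ∘ r⊆q)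

  NeighboursSeparated : Set
  NeighboursSeparated = ∀ {u x y v p q} → adj u x ≡ true → adj u y ≡ true →
                        Walk adj x v p → u ∉ p → Walk adj y v q → u ∉ q → x ≡ y

  separated⇒unique-paths : NeighboursSeparated → ∀ u v p q → Path adj u v p → Path adj u v q → p ≡ q
  separated⇒unique-paths sep u .u _ _ (here , _) (here , _) = refl
  separated⇒unique-paths sep u .u _ _ (here , _) (step _ walk , u∉ ∷ _) = ⊥-elim (All¬⇒¬Any u∉ (end∈ walk))
  separated⇒unique-paths sep u .u _ _ (step _ walk , u∉ ∷ _) (here , _) = ⊥-elim (All¬⇒¬Any u∉ (end∈ walk))
  separated⇒unique-paths sep u v _ _ (step e₁ walk₁ , u∉₁ ∷ !₁) (step e₂ walk₂ , u∉₂ ∷ !₂)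
    with sep e₁ e₂ walk₁ (All¬⇒¬Any u∉₁) walk₂ (All¬⇒¬Any u∉₂)
  ... | refl = cong (u ∷_) (separated⇒unique-paths sep _ v _ _ (walk₁ , !₁) (walk₂ , !₂))

module Degrees where

  open import Data.Nat using (zero; _+_; _<_; _≟_; s<s⁻¹)
  open import Data.Nat.Properties using (+-suc)
  open import Data.Nat.ListAction using (sum)
  open import Data.Bool using (true; false; if_then_else_; _∨_)
  open import Data.Fin using (toℕ)
  open import Data.List using ([]; _∷_; tabulate)
  open import Data.List.Properties using (map-tabulate)
  open import Data.List.Membership.DecPropositional _≟_ using (_∈?_)
  open import Data.List.Relation.Unary.All using (All; []; _∷_)
  open import Data.List.Relation.Unary.All.Properties using (All¬⇒¬Any)
  open import Data.List.Relation.Unary.AllPairs using (_∷_)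
  open import Data.List.Relation.Unary.Unique.Propositional using (Unique)
  open import Data.Empty using (⊥; ⊥-elim)
  open import Function using (_∘_; id)
  open import Relation.Binary.PropositionalEquality using (_≡_; refl; sym; trans; cong; cong₂; subst)
  open import Relation.Nullary using (Dec; does; proof)
  open import Relation.Nullary.Reflects using (Reflects; invert)

  from-does : ∀ {P : Set} (P? : Dec P) → does P? ≡ true → P
  from-does P? e = invert (subst (Reflects _) e (proof P?))

  count : ℕ → (ℕ → Bool) → ℕ
  count zero    g = 0
  count (suc k) g = (if g 0 then 1 else 0) + count k (g ∘ suc)

  degree≡count : ∀ {V} (g : ℕ → ℕ → Bool) (v : Fin V) →
                 degree (λ x y → g (toℕ x) (toℕ y)) v ≡ count V (g (toℕ v))
  degree≡count {V} g v =
    trans (cong sum (map-tabulate {n = V} id (λ w → if g (toℕ v) (toℕ w) then 1 else 0))) (sum-tabulate V (g (toℕ v)))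
    where
    sum-tabulate : ∀ k (h : ℕ → Bool) → sum (tabulate {n = k} (λ w → if h (toℕ w) then 1 else 0)) ≡ count k h
    sum-tabulate zero    h = refl
    sum-tabulate (suc k) h = cong ((if h 0 then 1 else 0) +_) (sum-tabulate k (h ∘ suc))

  count-false : ∀ k → count k (λ _ → false) ≡ 0
  count-false zero    = refl
  count-false (suc k) = count-false k

  count-≡ : ∀ {k e} → e < k → count k (λ j → does (j ≟ e)) ≡ 1
  count-≡ {suc k} {zero}  _   = cong suc (count-false k)
  count-≡ {suc k} {suc e} e<k = count-≡ (s<s⁻¹ e<k)

  count-∨ : ∀ k {g h : ℕ → Bool} → (∀ j → g j ≡ true → h j ≡ true → ⊥) →
            count k (λ j → g j ∨ h j) ≡ count k g + count k h
  count-∨ zero    _        = refl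
  count-∨ (suc k) {g} {h} disjoint with g 0 in g0 | h 0 in h0
  ... | true  | true  = ⊥-elim (disjoint 0 g0 h0)
  ... | true  | false = cong suc (count-∨ k (disjoint ∘ suc))
  ... | false | true  = trans (cong suc (count-∨ k (disjoint ∘ suc))) (sym (+-suc _ _))
  ... | false | false = count-∨ k (disjoint ∘ suc)

  count-∈ : ∀ {k ns} → Unique ns → All (_< k) ns → count k (λ j → does (j ∈? ns)) ≡ length ns
  count-∈ {k} {[]}     _            _            = count-false k
  count-∈ {k} {e ∷ ns} (e∉ns ∷ !ns) (e<k ∷ ns<k) =
    trans (count-∨ k disjoint) (cong₂ _+_ (count-≡ e<k) (count-∈ !ns ns<k))
    where
    disjoint : ∀ j → does (j ≟ e) ≡ true → does (j ∈? ns) ≡ true → ⊥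
    disjoint j j≡e j∈ns with from-does (j ≟ e) j≡e
    ... | refl = All¬⇒¬Any e∉ns (from-does (j ∈? ns) j∈ns)

  count-cong : ∀ k {g h : ℕ → Bool} → (∀ j → g j ≡ h j) → count k g ≡ count k h
  count-cong zero    _   = refl
  count-cong (suc k) g≗h = cong₂ (λ b c → (if b then 1 else 0) + c) (g≗h 0) (count-cong k (g≗h ∘ suc))

  degree≡length : ∀ {V} (g : ℕ → ℕ → Bool) (v : Fin V) {ns} → (∀ j → g (toℕ v) j ≡ does (j ∈? ns)) →
                  Unique ns → All (_< V) ns → degree (λ x y → g (toℕ x) (toℕ y)) v ≡ length ns
  degree≡length {V} g v neighbours !ns ns<V =
    trans (degree≡count g v) (trans (count-cong V neighbours) (count-∈ !ns ns<V))

module Separation where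

  open import Data.Nat using (_<_; _<?_; _⊔_; _⊓_; z≤n; s≤s)
  open import Data.Nat.Properties
  open import Data.List using ([]; _∷_; map)
  open import Data.List.Membership.Propositional using (_∈_)
  open import Data.List.Membership.Propositional.Properties using (∈-map⁻)
  open import Data.List.Relation.Unary.Any using (here; there)
  open import Data.Sum using (_⊎_; inj₁; inj₂)
  open import Data.Empty using (⊥; ⊥-elim)
  open import Function using (_∘_; _⇔_; mk⇔)
  open import Relation.Binary.PropositionalEquality using (_≡_; _≢_; refl; sym; trans; cong; subst)
  open import Relation.Nullary using (¬_; Dec)
  open import Relation.Nullary.Decidable using (_⊎-dec_)

  Separated : ℕ → ℕ → ℕ → ℕ → Set
  Separated a b c d = a ⊔ b < c ⊓ d ⊎ c ⊔ d < a ⊓ b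

  Between : ℕ → ℕ → ℕ → Set
  Between a b t = a ⊓ b ≤ t × t ≤ a ⊔ b

  between-≤ : ∀ {a b t} → a ≤ b → Between a b t ⇔ (a ≤ t × t ≤ b)
  between-≤ a≤b = mk⇔ (λ (l , u) → subst (_≤ _) (m≤n⇒m⊓n≡m a≤b) l , subst (_ ≤_) (m≤n⇒m⊔n≡n a≤b) u)
                      (λ (l , u) → subst (_≤ _) (sym (m≤n⇒m⊓n≡m a≤b)) l , subst (_ ≤_) (sym (m≤n⇒m⊔n≡n a≤b)) u)

  between-sym : ∀ {a b t} → Between a b t → Between b a t
  between-sym {a} {b} (l , u) = subst (_≤ _) (⊓-comm a b) l , subst (_ ≤_) (⊔-comm a b) u

  separated-disjoint : ∀ {a b c d t} → Separated a b c d → Between a b t → Between c d t → ⊥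
  separated-disjoint (inj₁ ab<cd) (_ , t≤ab) (cd≤t , _) = <⇒≱ ab<cd (≤-trans cd≤t t≤ab)
  separated-disjoint (inj₂ cd<ab) (ab≤t , _) (_ , t≤cd) = <⇒≱ cd<ab (≤-trans ab≤t t≤cd)

  not-separated-meet : ∀ a b c d → ¬ Separated a b c d → ∃[ t ] Between a b t × Between c d t
  not-separated-meet a b c d ¬sep = a ⊓ b ⊔ c ⊓ d ,
    (m≤m⊔n _ _ , ⊔-lub (≤-trans (m⊓n≤m a b) (m≤m⊔n a b)) (≮⇒≥ (¬sep ∘ inj₁))) ,
    (m≤n⊔m _ _ , ⊔-lub (≮⇒≥ (¬sep ∘ inj₂)) (≤-trans (m⊓n≤m c d) (m≤m⊔n c d)))

  separated? : ∀ a b c d → Dec (Separated a b c d)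
  separated? a b c d = (a ⊔ b <? c ⊓ d) ⊎-dec (c ⊔ d <? a ⊓ b)

  swap₁₂ : ℕ → ℕ
  swap₁₂ 1 = 2
  swap₁₂ 2 = 1
  swap₁₂ k = k

  swap₁₂-involutive : ∀ k → swap₁₂ (swap₁₂ k) ≡ k
  swap₁₂-involutive 0                   = refl
  swap₁₂-involutive 1                   = refl
  swap₁₂-involutive 2                   = refl
  swap₁₂-involutive (suc (suc (suc k))) = refl

  swap₁₂-injective : ∀ {j k} → swap₁₂ j ≡ swap₁₂ k → j ≡ k
  swap₁₂-injective {j} {k} e = trans (sym (swap₁₂-involutive j)) (trans (cong swap₁₂ e) (swap₁₂-involutive k))

  swap₁₂-monotone : ∀ {u v} → u < v → ¬ (u ≡ 1 × v ≡ 2) → swap₁₂ u < swap₁₂ v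
  swap₁₂-monotone {0}                   {1}                   _ _ = s≤s z≤n
  swap₁₂-monotone {0}                   {2}                   _ _ = s≤s z≤n
  swap₁₂-monotone {0}                   {suc (suc (suc v))}   _ _ = s≤s z≤n
  swap₁₂-monotone {1}                   {2}                   _ ¬12 = ⊥-elim (¬12 (refl , refl))
  swap₁₂-monotone {1}                   {suc (suc (suc v))}   _ _ = s≤s (s≤s (s≤s z≤n))
  swap₁₂-monotone {2}                   {suc (suc (suc v))}   _ _ = s≤s (s≤s z≤n)
  swap₁₂-monotone {suc (suc (suc u))}   {suc (suc (suc v))}   u<v _ = u<v
  swap₁₂-monotone {1}                   {1}                   (s≤s ())
  swap₁₂-monotone {2}                   {1}                   (s≤s ())
  swap₁₂-monotone {2}                   {2}                   (s≤s (s≤s ()))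
  swap₁₂-monotone {suc (suc (suc u))}   {1}                   (s≤s ())
  swap₁₂-monotone {suc (suc (suc u))}   {2}                   (s≤s (s≤s ()))

  Avoids012 : List ℕ → Set
  Avoids012 ks = 0 ∈ ks → 1 ∈ ks → 2 ∈ ks → ⊥

  avoids012-swap : ∀ {ks} → Avoids012 ks → Avoids012 (map swap₁₂ ks)
  avoids012-swap avoids 0∈ 1∈ 2∈ = avoids (preimage 0 0∈) (preimage 2 2∈) (preimage 1 1∈)
    where
    preimage : ∀ {ks} k → k ∈ map swap₁₂ ks → swap₁₂ k ∈ ks
    preimage k k∈ with ∈-map⁻ swap₁₂ k∈
    ... | j , j∈ , refl = subst (_∈ _) (sym (swap₁₂-involutive j)) j∈

  -- Only the comparison 1 < 2 is reversed by swap₁₂, and if u = 1, v = 2 then u′ = 0.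
  swap₁₂-< : ∀ {ks u u′ v} → Avoids012 ks → u′ ∈ ks → u ∈ ks → v ∈ ks → u′ ≢ u → u′ < v → u < v →
             swap₁₂ u < swap₁₂ v
  swap₁₂-< {u′ = 0}           avoids 0∈ 1∈ 2∈ _   _    u<v =
    swap₁₂-monotone u<v λ { (refl , refl) → avoids 0∈ 1∈ 2∈ }
  swap₁₂-< {u′ = 1}           _      _  _  _  1≢u _    u<v =
    swap₁₂-monotone u<v λ { (refl , _) → 1≢u refl }
  swap₁₂-< {u′ = suc (suc _)} _      _  _  _  _   u′<v u<v =
    swap₁₂-monotone u<v λ (_ , v≡2) → <⇒≱ u′<v (subst (_≤ _) (sym v≡2) (s≤s (s≤s z≤n)))

  ⊔<⊓-components : ∀ {a b c d} → a ⊔ b < c ⊓ d → a < c × a < d × b < c × b < d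
  ⊔<⊓-components {a} {b} {c} {d} ab<cd =
    ≤-<-trans (m≤m⊔n a b) (<-≤-trans ab<cd (m⊓n≤m c d)) ,
    ≤-<-trans (m≤m⊔n a b) (<-≤-trans ab<cd (m⊓n≤n c d)) ,
    ≤-<-trans (m≤n⊔m a b) (<-≤-trans ab<cd (m⊓n≤m c d)) ,
    ≤-<-trans (m≤n⊔m a b) (<-≤-trans ab<cd (m⊓n≤n c d))

  below-swap : ∀ {ks a b c d} → Avoids012 ks → a ∈ ks → b ∈ ks → c ∈ ks → d ∈ ks → a ≢ b →
               a ⊔ b < c ⊓ d → swap₁₂ a ⊔ swap₁₂ b < swap₁₂ c ⊓ swap₁₂ d
  below-swap avoids a∈ b∈ c∈ d∈ a≢b ab<cd with ⊔<⊓-components ab<cd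
  ... | a<c , a<d , b<c , b<d =
    ⊓-glb (⊔-lub (swap₁₂-< avoids b∈ a∈ c∈ (a≢b ∘ sym) b<c a<c) (swap₁₂-< avoids a∈ b∈ c∈ a≢b a<c b<c))
          (⊔-lub (swap₁₂-< avoids b∈ a∈ d∈ (a≢b ∘ sym) b<d a<d) (swap₁₂-< avoids a∈ b∈ d∈ a≢b a<d b<d))

  separated-swap : ∀ {a b c d} → a ≢ b → c ≢ d → Avoids012 (a ∷ b ∷ c ∷ d ∷ []) →
                   Separated a b c d → Separated (swap₁₂ a) (swap₁₂ b) (swap₁₂ c) (swap₁₂ d)
  separated-swap a≢b c≢d avoids (inj₁ ab<cd) =
    inj₁ (below-swap avoids (here refl) (there (here refl)) (there (there (here refl)))
                     (there (there (there (here refl)))) a≢b ab<cd)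
  separated-swap a≢b c≢d avoids (inj₂ cd<ab) =
    inj₂ (below-swap avoids (there (there (here refl))) (there (there (there (here refl))))
                     (here refl) (there (here refl)) c≢d cd<ab)

  separated⇔swap : ∀ {a b c d} → a ≢ b → c ≢ d → Avoids012 (a ∷ b ∷ c ∷ d ∷ []) →
                   Separated a b c d ⇔ Separated (swap₁₂ a) (swap₁₂ b) (swap₁₂ c) (swap₁₂ d)
  separated⇔swap {a} {b} {c} {d} a≢b c≢d avoids = mk⇔ (separated-swap a≢b c≢d avoids) backward
    where
    backward : Separated (swap₁₂ a) (swap₁₂ b) (swap₁₂ c) (swap₁₂ d) → Separated a b c d
    backward sep with separated-swap (a≢b ∘ swap₁₂-injective) (c≢d ∘ swap₁₂-injective) (avoids012-swap avoids) sep
    ... | sep′ rewrite swap₁₂-involutive a | swap₁₂-involutive b | swap₁₂-involutive c | swap₁₂-involutive d =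
      sep′

module Permutations where

  open import Data.Nat using (_+_)
  open import Data.Fin using (zero; suc; toℕ; _≟_)
  open import Data.Fin.Properties using (0≢1+n; suc-injective)
  open import Data.Fin.Permutation
    using (Permutation′; _⟨$⟩ʳ_; _⟨$⟩ˡ_; inverseˡ; transpose; _∘ₚ_; id; permutation)
  open import Function using (_∘_)
  open import Relation.Binary.PropositionalEquality using (_≡_; _≢_; refl; sym; trans; cong)
  open import Relation.Nullary.Decidable using (dec-true; dec-false)
  open Separation using (swap₁₂)

  private variable k : ℕ

  swap₁₂ᶠ : Fin (3 + k) → Fin (3 + k)
  swap₁₂ᶠ zero                = zero
  swap₁₂ᶠ (suc zero)          = suc (suc zero)
  swap₁₂ᶠ (suc (suc zero))    = suc zero
  swap₁₂ᶠ (suc (suc (suc i))) = suc (suc (suc i))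

  swap₁₂ᶠ-involutive : (i : Fin (3 + k)) → swap₁₂ᶠ (swap₁₂ᶠ i) ≡ i
  swap₁₂ᶠ-involutive zero                = refl
  swap₁₂ᶠ-involutive (suc zero)          = refl
  swap₁₂ᶠ-involutive (suc (suc zero))    = refl
  swap₁₂ᶠ-involutive (suc (suc (suc i))) = refl

  toℕ-swap₁₂ᶠ : (i : Fin (3 + k)) → toℕ (swap₁₂ᶠ i) ≡ swap₁₂ (toℕ i)
  toℕ-swap₁₂ᶠ zero                = refl
  toℕ-swap₁₂ᶠ (suc zero)          = refl
  toℕ-swap₁₂ᶠ (suc (suc zero))    = refl
  toℕ-swap₁₂ᶠ (suc (suc (suc i))) = refl

  τ : Permutation′ (3 + k)
  τ = permutation swap₁₂ᶠ swap₁₂ᶠ swap₁₂ᶠ-involutive swap₁₂ᶠ-involutive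

  permutation-injective : ∀ {n} (σ : Permutation′ n) {x y} → σ ⟨$⟩ʳ x ≡ σ ⟨$⟩ʳ y → x ≡ y
  permutation-injective σ e = trans (sym (inverseˡ σ)) (trans (cong (σ ⟨$⟩ˡ_) e) (inverseˡ σ))

  transpose-matchˡ : ∀ {n} (i j : Fin n) → transpose i j ⟨$⟩ʳ i ≡ j
  transpose-matchˡ i j rewrite dec-true (i ≟ i) refl = refl

  transpose-fixes : ∀ {n} {i j l : Fin n} → l ≢ i → l ≢ j → transpose i j ⟨$⟩ʳ l ≡ l
  transpose-fixes {i = i} {j} {l} l≢i l≢j rewrite dec-false (l ≟ i) l≢i | dec-false (l ≟ j) l≢j = refl

  place : ∀ {n} (σ : Permutation′ n) x l →
          ∃[ σ′ ] σ′ ⟨$⟩ʳ x ≡ l × (∀ {y} → y ≢ x → σ ⟨$⟩ʳ y ≢ l → σ′ ⟨$⟩ʳ y ≡ σ ⟨$⟩ʳ y)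
  place σ x l = σ ∘ₚ transpose (σ ⟨$⟩ʳ x) l , transpose-matchˡ (σ ⟨$⟩ʳ x) l ,
                λ y≢x σy≢l → transpose-fixes (y≢x ∘ permutation-injective σ) σy≢l

  placing-012 : ∀ {a b c : Fin (3 + k)} → a ≢ b → a ≢ c → b ≢ c →
                ∃[ σ ] σ ⟨$⟩ʳ a ≡ zero × σ ⟨$⟩ʳ b ≡ suc zero × σ ⟨$⟩ʳ c ≡ suc (suc zero)
  placing-012 {a = a} {b} {c} a≢b a≢c b≢c with place id a zero
  ... | σ₁ , σ₁a , _ with place σ₁ b (suc zero)
  ... | σ₂ , σ₂b , σ₂-fixes with place σ₂ c (suc (suc zero))
  ... | σ₃ , σ₃c , σ₃-fixes =
    let σ₂a = trans (σ₂-fixes a≢b (0≢1+n ∘ trans (sym σ₁a))) σ₁a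
    in  σ₃ , trans (σ₃-fixes a≢c (0≢1+n ∘ trans (sym σ₂a))) σ₂a
           , trans (σ₃-fixes b≢c (0≢1+n ∘ suc-injective ∘ trans (sym σ₂b))) σ₂b
           , σ₃c

module Caterpillar (S : ℕ) where

  open import Data.Nat using (zero; _+_; _∸_; _<_; _≤′_; ≤′-refl; ≤′-step; _≤?_; _≟_; z≤n; s≤s; s≤s⁻¹)
  open import Data.Nat.Properties
  open import Data.Bool using (true; false)
  open import Data.Fin using (toℕ; fromℕ<)
  open import Data.Fin.Properties using (toℕ-injective; toℕ-fromℕ<; toℕ<n)
  open import Data.Fin.Permutation using (Permutation′; _⟨$⟩ʳ_; _⟨$⟩ˡ_; inverseʳ)
  open import Data.Product using (proj₁; proj₂)
  open import Data.List using ([]; _∷_)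
  open import Data.List.Membership.Propositional using (_∈_; _∉_)
  open import Data.List.Membership.DecPropositional _≟_ using (_∈?_)
  open import Data.List.Relation.Unary.Any using (here; there)
  open import Data.List.Relation.Unary.All as All using (All; []; _∷_)
  open import Data.List.Relation.Unary.All.Properties using (++⁺)
  open import Data.List.Relation.Unary.AllPairs using ([]; _∷_)
  open import Data.List.Relation.Unary.Unique.Propositional using (Unique)
  open import Data.List.Relation.Binary.Subset.Propositional.Properties using (All-resp-⊇)
  open import Data.Sum using (_⊎_; inj₁; inj₂; [_,_]; swap)
  open import Data.Empty using (⊥; ⊥-elim)
  open import Function using (_∘_; _⇔_; mk⇔; Equivalence)
  open import Relation.Binary.PropositionalEquality using (_≡_; _≢_; refl; sym; trans; cong; subst; subst₂)
  open import Relation.Nullary using (¬_; Dec; yes; no; does)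
  open import Relation.Nullary.Decidable using (_×-dec_; _⊎-dec_; map′; dec-true; dec-false; does-⇔)
  open Degrees
  open Separation
    using (Separated; Between; between-≤; between-sym; separated?; separated-disjoint; not-separated-meet)
  open Permutations using (permutation-injective)

  -- Vertices 0 … S+1 form the spine and vertex S+1+i (1 ≤ i ≤ S) is a pendant leaf at spine vertex i.
  -- The leaf at position p is spine vertex p for p ∈ {0, S+1} and the pendant at p otherwise;
  -- coordℕ projects every vertex onto the spine, so a leaf's coordinate is its position.

  n : ℕ
  n = suc (suc S)

  NV : ℕ
  NV = n + S

  data Arc (a b : ℕ) : Set where
    spine   : b ≡ suc a → a ≤ S → Arc a b
    pendant : b ≡ suc S + a → 1 ≤ a → a ≤ S → Arc a b

  Edge : ℕ → ℕ → Set
  Edge a b = Arc a b ⊎ Arc b a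

  arc? : ∀ a b → Dec (Arc a b)
  arc? a b = map′ [ (λ (e , a≤S) → spine e a≤S) , (λ (e , 1≤a , a≤S) → pendant e 1≤a a≤S) ] from
                  (((b ≟ suc a) ×-dec (a ≤? S)) ⊎-dec ((b ≟ suc S + a) ×-dec (1 ≤? a) ×-dec (a ≤? S)))
    where
    from : Arc a b → (b ≡ suc a × a ≤ S) ⊎ (b ≡ suc S + a × 1 ≤ a × a ≤ S)
    from (spine e a≤S)       = inj₁ (e , a≤S)
    from (pendant e 1≤a a≤S) = inj₂ (e , 1≤a , a≤S)

  edge? : ∀ a b → Dec (Edge a b)
  edge? a b = arc? a b ⊎-dec arc? b a

  arc-irreflexive : ∀ {a} → ¬ Arc a a
  arc-irreflexive (spine e _)     = 1+n≢n (sym e)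
  arc-irreflexive (pendant e _ _) = m≢1+n+m _ e

  coordℕ : ℕ → ℕ
  coordℕ k with k ≤? suc S
  ... | yes _ = k
  ... | no  _ = k ∸ suc S

  Spineℕ : ℕ → Set
  Spineℕ k = coordℕ k ≡ k

  coordℕ-spine : ∀ {t} → t ≤ suc S → Spineℕ t
  coordℕ-spine {t} t≤ with t ≤? suc S
  ... | yes _ = refl
  ... | no  t≰ = ⊥-elim (t≰ t≤)

  coordℕ-pendant : ∀ {i} → 1 ≤ i → coordℕ (suc S + i) ≡ i
  coordℕ-pendant {i} 1≤i with suc S + i ≤? suc S
  ... | yes ≤1+S = ⊥-elim (<⇒≱ (m<m+n (suc S) 1≤i) ≤1+S)
  ... | no  _ = m+n∸m≡n (suc S) i

  pendant-not-spine : ∀ {i} → 1 ≤ i → ¬ Spineℕ (suc S + i)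
  pendant-not-spine {i} 1≤i on-spine = m≢1+n+m i (trans (sym (coordℕ-pendant 1≤i)) on-spine)

  spine-successor : ∀ {t} → t ≤ S → coordℕ (suc t) ≡ suc (coordℕ t)
  spine-successor t≤S = trans (coordℕ-spine (s≤s t≤S)) (cong suc (sym (coordℕ-spine (m≤n⇒m≤1+n t≤S))))

  pendant-coordinate : ∀ {i} → 1 ≤ i → i ≤ S → coordℕ (suc S + i) ≡ coordℕ i
  pendant-coordinate 1≤i i≤S = trans (coordℕ-pendant 1≤i) (sym (coordℕ-spine (m≤n⇒m≤1+n i≤S)))

  data EdgeView (a b : ℕ) : Set where
    up    : Spineℕ a → Spineℕ b → coordℕ b ≡ suc (coordℕ a) → EdgeView a b
    down  : Spineℕ a → Spineℕ b → coordℕ a ≡ suc (coordℕ b) → EdgeView a b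
    leave : Spineℕ a → ¬ Spineℕ b → coordℕ b ≡ coordℕ a → EdgeView a b
    enter : ¬ Spineℕ a → Spineℕ b → coordℕ b ≡ coordℕ a → EdgeView a b

  edge-view : ∀ {a b} → Edge a b → EdgeView a b
  edge-view (inj₁ (spine refl a≤S)) =
    up (coordℕ-spine (m≤n⇒m≤1+n a≤S)) (coordℕ-spine (s≤s a≤S)) (spine-successor a≤S)
  edge-view (inj₂ (spine refl b≤S)) =
    down (coordℕ-spine (s≤s b≤S)) (coordℕ-spine (m≤n⇒m≤1+n b≤S)) (spine-successor b≤S)
  edge-view (inj₁ (pendant refl 1≤a a≤S)) =
    leave (coordℕ-spine (m≤n⇒m≤1+n a≤S)) (pendant-not-spine 1≤a) (pendant-coordinate 1≤a a≤S)
  edge-view (inj₂ (pendant refl 1≤b b≤S)) =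
    enter (pendant-not-spine 1≤b) (coordℕ-spine (m≤n⇒m≤1+n b≤S)) (sym (pendant-coordinate 1≤b b≤S))

  adjacency : Fin NV → Fin NV → Bool
  adjacency x y = does (edge? (toℕ x) (toℕ y))

  adjacency-sym : ∀ x y → adjacency x y ≡ adjacency y x
  adjacency-sym x y = does-⇔ (mk⇔ swap swap) (edge? (toℕ x) (toℕ y)) (edge? (toℕ y) (toℕ x))

  adjacency-irr : ∀ x → adjacency x x ≡ false
  adjacency-irr x = dec-false (edge? (toℕ x) (toℕ x)) [ arc-irreflexive , arc-irreflexive ]

  edge-of : ∀ {x y} → adjacency x y ≡ true → Edge (toℕ x) (toℕ y)
  edge-of {x} {y} = from-does (edge? (toℕ x) (toℕ y))

  arc-adjacent : ∀ {x y} → Arc (toℕ x) (toℕ y) → adjacency x y ≡ true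
  arc-adjacent {x} {y} arc = dec-true (edge? (toℕ x) (toℕ y)) (inj₁ arc)

  view : ∀ {x y} → adjacency x y ≡ true → EdgeView (toℕ x) (toℕ y)
  view = edge-view ∘ edge-of

  coord : Fin NV → ℕ
  coord x = coordℕ (toℕ x)

  OnSpine : Fin NV → Set
  OnSpine x = Spineℕ (toℕ x)

  on-spine? : ∀ x → Dec (OnSpine x)
  on-spine? x = coord x ≟ toℕ x

  spine-injective : ∀ {x y} → OnSpine x → OnSpine y → coord x ≡ coord y → x ≡ y
  spine-injective sx sy e = toℕ-injective (trans (sym sx) (trans e sy))

  pendant-neighbour : ∀ {x y} → ¬ OnSpine x → adjacency x y ≡ true → OnSpine y × coord y ≡ coord x
  pendant-neighbour ¬sx e with view e
  ... | up    sx _ _ = ⊥-elim (¬sx sx)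
  ... | down  sx _ _ = ⊥-elim (¬sx sx)
  ... | leave sx _ _ = ⊥-elim (¬sx sx)
  ... | enter _ sy c = sy , c

  pendant-neighbours-equal : ∀ {x y z} → ¬ OnSpine x → adjacency x y ≡ true → adjacency x z ≡ true → z ≡ y
  pendant-neighbours-equal ¬sx e₁ e₂ with pendant-neighbour ¬sx e₁ | pendant-neighbour ¬sx e₂
  ... | sy , cy | sz , cz = spine-injective sz sy (trans cz (sym cy))

  open WalkProperties adjacency

  above-invariant : ∀ {u x v p} → OnSpine u → Walk adjacency x v p → u ∉ p → coord u < coord x → coord u < coord v
  above-invariant {u} su walk u∉p = avoiding-invariant (λ y → coord u < coord y) preserved walk u∉p
    where
    preserved : ∀ {y y′} → coord u < coord y → adjacency y y′ ≡ true → y′ ≢ u → coord u < coord y′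
    preserved u<y e y′≢u with view e
    ... | up    _ _ c = subst (coord u <_) (sym c) (m<n⇒m<1+n u<y)
    ... | leave _ _ c = subst (coord u <_) (sym c) u<y
    ... | enter _ _ c = subst (coord u <_) (sym c) u<y
    ... | down  _ sy′ c with m≤n⇒m<n∨m≡n (s≤s⁻¹ (subst (coord u <_) c u<y))
    ...   | inj₁ u<y′ = u<y′
    ...   | inj₂ u≡y′ = ⊥-elim (y′≢u (spine-injective sy′ su (sym u≡y′)))

  below-invariant : ∀ {u x v p} → OnSpine u → Walk adjacency x v p → u ∉ p → coord x < coord u → coord v < coord u
  below-invariant {u} su walk u∉p = avoiding-invariant (λ y → coord y < coord u) preserved walk u∉p
    where
    preserved : ∀ {y y′} → coord y < coord u → adjacency y y′ ≡ true → y′ ≢ u → coord y′ < coord u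
    preserved {y′ = y′} y<u e y′≢u with view e
    ... | down  _ _ c = <-trans (subst (coord y′ <_) (sym c) (n<1+n (coord y′))) y<u
    ... | leave _ _ c = subst (_< coord u) (sym c) y<u
    ... | enter _ _ c = subst (_< coord u) (sym c) y<u
    ... | up    _ sy′ c with m≤n⇒m<n∨m≡n (subst (_≤ coord u) (sym c) y<u)
    ...   | inj₁ y′<u = y′<u
    ...   | inj₂ y′≡u = ⊥-elim (y′≢u (spine-injective sy′ su y′≡u))

  pendant-trap : ∀ {u x y v p q} → ¬ OnSpine x → adjacency u x ≡ true →
                 Walk adjacency x v p → u ∉ p → Walk adjacency y v q → u ∉ q → y ≡ x
  pendant-trap {u} {x} ¬sx ux walk₁ u∉p walk₂ u∉q =
    walk-to-pendant adjacency-sym only-u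
      (subst (λ v → Walk adjacency _ v _) (walk-from-pendant only-u walk₁ u∉p) walk₂) u∉q
    where
    only-u : ∀ {y} → adjacency x y ≡ true → y ≡ u
    only-u = pendant-neighbours-equal ¬sx (trans (adjacency-sym x u) ux)

  -- Deleting a spine vertex cuts the caterpillar into its parts of smaller and of larger coordinate
  -- and its pendant; deleting the spine neighbour of a pendant isolates the pendant.
  neighbours-separated : NeighboursSeparated
  neighbours-separated {u} {x₁} {x₂} e₁ e₂ walk₁ u∉₁ walk₂ u∉₂
    with on-spine? u | on-spine? x₁ | on-spine? x₂
  ... | no ¬su | _      | _      = sym (pendant-neighbours-equal ¬su e₁ e₂)
  ... | yes _  | no ¬s₁ | _      = sym (pendant-trap ¬s₁ e₁ walk₁ u∉₁ walk₂ u∉₂)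
  ... | yes _  | yes _  | no ¬s₂ = pendant-trap ¬s₂ e₂ walk₂ u∉₂ walk₁ u∉₁
  ... | yes su | yes s₁ | yes s₂ = spine-neighbours (view e₁) (view e₂)
    where
    spine-neighbours : EdgeView (toℕ u) (toℕ x₁) → EdgeView (toℕ u) (toℕ x₂) → x₁ ≡ x₂
    spine-neighbours (up _ _ c₁)   (up _ _ c₂)   = spine-injective s₁ s₂ (trans c₁ (sym c₂))
    spine-neighbours (down _ _ c₁) (down _ _ c₂) = spine-injective s₁ s₂ (suc-injective (trans (sym c₁) c₂))
    spine-neighbours (up _ _ c₁)   (down _ _ c₂) = ⊥-elim (<-asym
      (above-invariant su walk₁ u∉₁ (subst (coord u <_) (sym c₁) (n<1+n (coord u))))
      (below-invariant su walk₂ u∉₂ (subst (coord x₂ <_) (sym c₂) (n<1+n (coord x₂)))))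
    spine-neighbours (down _ _ c₁) (up _ _ c₂)   = ⊥-elim (<-asym
      (above-invariant su walk₂ u∉₂ (subst (coord u <_) (sym c₂) (n<1+n (coord u))))
      (below-invariant su walk₁ u∉₁ (subst (coord x₁ <_) (sym c₁) (n<1+n (coord x₁)))))
    spine-neighbours (leave _ ¬s _) _ = ⊥-elim (¬s s₁)
    spine-neighbours (enter ¬s _ _) _ = ⊥-elim (¬s su)
    spine-neighbours _ (leave _ ¬s _) = ⊥-elim (¬s s₂)
    spine-neighbours _ (enter ¬s _ _) = ⊥-elim (¬s su)

  ∸[1+S]≤S : ∀ {k} → k < NV → k ∸ suc S ≤ S
  ∸[1+S]≤S k<NV = ≤-trans (∸-monoˡ-≤ (suc S) (s≤s⁻¹ k<NV)) (≤-reflexive (m+n∸m≡n (suc S) S))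

  coordℕ≤ : ∀ {k} → k < NV → coordℕ k ≤ suc S
  coordℕ≤ {k} k<NV with k ≤? suc S
  ... | yes k≤ = k≤
  ... | no  _  = m≤n⇒m≤1+n (∸[1+S]≤S k<NV)

  pendant-index : ∀ {k} → k < NV → ¬ Spineℕ k → k ≡ suc S + coordℕ k × 1 ≤ coordℕ k × coordℕ k ≤ S
  pendant-index {k} k<NV ¬sk with k ≤? suc S
  ... | yes _  = ⊥-elim (¬sk refl)
  ... | no  k≰ = sym (m+[n∸m]≡n (<⇒≤ (≰⇒> k≰))) , m<n⇒0<n∸m (≰⇒> k≰) , ∸[1+S]≤S k<NV

  spine<NV : ∀ {t} → t ≤ suc S → t < NV
  spine<NV t≤ = ≤-trans (s≤s t≤) (m≤m+n n S)

  coord-spine : ∀ {x t} → toℕ x ≡ t → t ≤ suc S → coord x ≡ t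
  coord-spine refl t≤ = coordℕ-spine t≤

  spine-below : ∀ x → Fin NV
  spine-below x = fromℕ< (spine<NV (coordℕ≤ (toℕ<n x)))

  toℕ-spine-below : ∀ x → toℕ (spine-below x) ≡ coord x
  toℕ-spine-below x = toℕ-fromℕ< (spine<NV (coordℕ≤ (toℕ<n x)))

  to-spine : ∀ x → ∃[ p ] Walk adjacency x (spine-below x) p × All (λ z → coord z ≡ coord x) p
  to-spine x with on-spine? x
  ... | yes sx = _ , subst (λ s → Walk adjacency x s (x ∷ [])) x≡ here , refl ∷ []
    where
    x≡ : x ≡ spine-below x
    x≡ = toℕ-injective (trans (sym sx) (sym (toℕ-spine-below x)))
  ... | no ¬sx = _ , step edge here , refl ∷ coord-spine (toℕ-spine-below x) (coordℕ≤ (toℕ<n x)) ∷ []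
    where
    edge : adjacency x (spine-below x) ≡ true
    edge with pendant-index (toℕ<n x) ¬sx
    ... | x≡ , 1≤ , ≤S = trans (adjacency-sym x (spine-below x)) (arc-adjacent (pendant
      (trans x≡ (cong (suc S +_) (sym t≡))) (subst (1 ≤_) (sym t≡) 1≤) (subst (_≤ S) (sym t≡) ≤S)))
      where
      t≡ : toℕ (spine-below x) ≡ coord x
      t≡ = toℕ-spine-below x

  InRange : ℕ → ℕ → Fin NV → Set
  InRange i j z = i ≤ coord z × coord z ≤ j

  spine-predecessor : ∀ {j y} → toℕ y ≡ suc j → suc j ≤ suc S → ∃[ y′ ] toℕ y′ ≡ j × adjacency y′ y ≡ true
  spine-predecessor {j} y≡ (s≤s j≤S) =
    fromℕ< j<NV , toℕ-fromℕ< j<NV ,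
    arc-adjacent (spine (trans y≡ (cong suc (sym (toℕ-fromℕ< j<NV)))) (subst (_≤ S) (sym (toℕ-fromℕ< j<NV)) j≤S))
    where
    j<NV : j < NV
    j<NV = spine<NV (m≤n⇒m≤1+n j≤S)

  spine-walk : ∀ {i j x y} → i ≤′ j → j ≤ suc S → toℕ x ≡ i → toℕ y ≡ j →
               ∃[ p ] Walk adjacency x y p × All (InRange i j) p
  spine-walk {x = x} ≤′-refl j≤ x≡ y≡ with toℕ-injective (trans x≡ (sym y≡))
  ... | refl = _ , here , (≤-reflexive (sym (coord-spine x≡ j≤)) , ≤-reflexive (coord-spine x≡ j≤)) ∷ []
  spine-walk {i} {suc j} {y = y} (≤′-step i≤′j) j+1≤ x≡ y≡ with spine-predecessor y≡ j+1≤
  ... | y′ , y′≡ , edge with spine-walk i≤′j (≤-trans (n≤1+n j) j+1≤) x≡ y′≡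
  ... | p , walk , in-range with walk-++ walk (step edge here)
  ... | r , walk′ , r⊆ =
    r , walk′ , All-resp-⊇ r⊆ (++⁺ (All.map (λ (i≤ , ≤j) → i≤ , m≤n⇒m≤1+n ≤j) in-range) (y′-in ∷ y-in ∷ []))
    where
    i≤j : i ≤ j
    i≤j = ≤′⇒≤ i≤′j
    y′-in : InRange i (suc j) y′
    y′-in = subst (λ c → i ≤ c × c ≤ suc j) (sym (coord-spine y′≡ (≤-trans (n≤1+n j) j+1≤))) (i≤j , n≤1+n j)
    y-in : InRange i (suc j) y
    y-in = subst (λ c → i ≤ c × c ≤ suc j) (sym (coord-spine y≡ j+1≤)) (m≤n⇒m≤1+n i≤j , ≤-refl)

  ordered-walk : ∀ x y → coord x ≤ coord y → ∃[ p ] Walk adjacency x y p × All (InRange (coord x) (coord y)) p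
  ordered-walk x y cx≤cy
    with to-spine x
       | spine-walk (≤⇒≤′ cx≤cy) (coordℕ≤ (toℕ<n y)) (toℕ-spine-below x) (toℕ-spine-below y)
       | to-spine y
  ... | _ , walk₁ , at-x | _ , walk₂ , along | _ , walk₃ , at-y with walk-reverse adjacency-sym walk₃
  ... | _ , walk₃′ , r₃⊆ with walk-++ walk₁ walk₂
  ... | _ , walk₁₂ , r₁₂⊆ with walk-++ walk₁₂ walk₃′
  ... | r , walk , r⊆ =
    r , walk , All-resp-⊇ r⊆ (++⁺ (All-resp-⊇ r₁₂⊆ (++⁺ (All.map (λ {z} → at-start {z}) at-x) along))
                                 (All-resp-⊇ r₃⊆ (All.map (λ {z} → at-end {z}) at-y)))
    where
    at-start : ∀ {z} → coord z ≡ coord x → InRange (coord x) (coord y) z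
    at-start z≡x = ≤-reflexive (sym z≡x) , subst (_≤ coord y) (sym z≡x) cx≤cy
    at-end : ∀ {z} → coord z ≡ coord y → InRange (coord x) (coord y) z
    at-end z≡y = subst (coord x ≤_) (sym z≡y) cx≤cy , ≤-reflexive z≡y

  walk-between : ∀ x y → ∃[ p ] Walk adjacency x y p × All (λ z → Between (coord x) (coord y) (coord z)) p
  walk-between x y with ≤-total (coord x) (coord y)
  ... | inj₁ x≤y with ordered-walk x y x≤y
  ...   | p , walk , in-range = p , walk , All.map (Equivalence.from (between-≤ x≤y)) in-range
  walk-between x y | inj₂ y≤x with ordered-walk y x y≤x
  ...   | _ , walk , in-range with walk-reverse adjacency-sym walk
  ...     | p , back , p⊆ =
    p , back , All.map (between-sym ∘ Equivalence.from (between-≤ y≤x)) (All-resp-⊇ p⊆ in-range)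

  caterpillar-connected : ∀ x y → ∃[ p ] Path adjacency x y p
  caterpillar-connected x y with walk⇒path (proj₁ (proj₂ (walk-between x y)))
  ... | p , path , _ = p , path

  leafℕ : ℕ → ℕ
  leafℕ p with 1 ≤? p | p ≤? S
  ... | yes _ | yes _ = suc S + p
  ... | yes _ | no  _ = p
  ... | no  _ | _     = p

  leafℕ-cases : ∀ p → (1 ≤ p × p ≤ S × leafℕ p ≡ suc S + p) ⊎ (¬ (1 ≤ p × p ≤ S) × leafℕ p ≡ p)
  leafℕ-cases p with 1 ≤? p | p ≤? S
  ... | yes 1≤p | yes p≤S = inj₁ (1≤p , p≤S , refl)
  ... | yes _   | no  p≰S = inj₂ (p≰S ∘ proj₂ , refl)
  ... | no  1≰p | _       = inj₂ (1≰p ∘ proj₁ , refl)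

  leafℕ-pendant : ∀ {i} → 1 ≤ i → i ≤ S → leafℕ i ≡ suc S + i
  leafℕ-pendant {i} 1≤i i≤S with leafℕ-cases i
  ... | inj₁ (_ , _ , e) = e
  ... | inj₂ (¬pendant , _) = ⊥-elim (¬pendant (1≤i , i≤S))

  leafℕ-last : leafℕ (suc S) ≡ suc S
  leafℕ-last with leafℕ-cases (suc S)
  ... | inj₁ (_ , S+1≤S , _) = ⊥-elim (1+n≰n S+1≤S)
  ... | inj₂ (_ , e) = e

  leafℕ<NV : ∀ {p} → p ≤ suc S → leafℕ p < NV
  leafℕ<NV {p} p≤ with leafℕ-cases p
  ... | inj₁ (_ , p≤S , e) = subst (_< NV) (sym e) (s≤s (+-monoʳ-≤ (suc S) p≤S))
  ... | inj₂ (_ , e)       = subst (_< NV) (sym e) (spine<NV p≤)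

  coordℕ-leafℕ : ∀ {p} → p ≤ suc S → coordℕ (leafℕ p) ≡ p
  coordℕ-leafℕ {p} p≤ with leafℕ-cases p
  ... | inj₁ (1≤p , _ , e) = trans (cong coordℕ e) (coordℕ-pendant 1≤p)
  ... | inj₂ (_ , e)       = trans (cong coordℕ e) (coordℕ-spine p≤)

  position≤ : (p : Fin n) → toℕ p ≤ suc S
  position≤ p = s≤s⁻¹ (toℕ<n p)

  leaf-vertex : Fin n → Fin NV
  leaf-vertex p = fromℕ< (leafℕ<NV (position≤ p))

  toℕ-leaf-vertex : ∀ p → toℕ (leaf-vertex p) ≡ leafℕ (toℕ p)
  toℕ-leaf-vertex p = toℕ-fromℕ< (leafℕ<NV (position≤ p))

  leaf-vertex-at : ∀ {p t} → toℕ p ≡ t → toℕ (leaf-vertex p) ≡ leafℕ t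
  leaf-vertex-at {p} refl = toℕ-leaf-vertex p

  coord-leaf-vertex : ∀ p → coord (leaf-vertex p) ≡ toℕ p
  coord-leaf-vertex p = trans (cong coordℕ (toℕ-leaf-vertex p)) (coordℕ-leafℕ (position≤ p))

  leaf-vertex-injective : ∀ {p q} → leaf-vertex p ≡ leaf-vertex q → p ≡ q
  leaf-vertex-injective {p} {q} e =
    toℕ-injective (trans (sym (coord-leaf-vertex p)) (trans (cong coord e) (coord-leaf-vertex q)))

  step-toward : ∀ {x x₁ t} → adjacency x x₁ ≡ true → coord x < t → coord x₁ ≤ t
  step-toward {x} {x₁} {t} e x<t with view {x} {x₁} e
  ... | up    _ _ c = subst (_≤ t) (sym c) x<t
  ... | down  _ _ c = ≤-trans (≤-trans (n≤1+n (coord x₁)) (≤-reflexive (sym c))) (<⇒≤ x<t)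
  ... | leave _ _ c = subst (_≤ t) (sym c) (<⇒≤ x<t)
  ... | enter _ _ c = subst (_≤ t) (sym c) (<⇒≤ x<t)

  -- The last hypothesis excludes the trivial walk at a pendant, which meets no spine vertex.
  crossing : ∀ {x y p} t → Walk adjacency x y p → coord x ≤ t → t ≤ coord y → OnSpine x ⊎ x ≢ y →
             ∃[ z ] z ∈ p × toℕ z ≡ t
  crossing t here x≤t t≤y (inj₁ sx) = _ , here refl , trans (sym sx) (≤-antisym x≤t t≤y)
  crossing t here x≤t t≤y (inj₂ x≢x) = ⊥-elim (x≢x refl)
  crossing {x} {y} t (step {w = x₁} e walk) x≤t t≤y _ with m≤n⇒m<n∨m≡n x≤t | on-spine? x
  ... | inj₂ x≡t | yes sx  = x , here refl , trans (sym sx) x≡t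
  ... | inj₂ x≡t | no  ¬sx =
    let sx₁ , c₁ = pendant-neighbour {x} {x₁} ¬sx e in x₁ , there (start∈ walk) , trans (sym sx₁) (trans c₁ x≡t)
  ... | inj₁ x<t | _ =
    let z , z∈ , z≡ = crossing t walk (step-toward {x} {x₁} e x<t) t≤y next-condition in z , there z∈ , z≡
    where
    next-condition : OnSpine x₁ ⊎ x₁ ≢ y
    next-condition with on-spine? x₁
    ... | yes sx₁ = inj₁ sx₁
    ... | no ¬sx₁ = inj₂ λ { refl →
      <⇒≱ (subst (_< t) (proj₂ (pendant-neighbour {x₁} {x} ¬sx₁ (trans (adjacency-sym x₁ x) e))) x<t) t≤y }

  crossing-between : ∀ {x y p} t → x ≢ y → Walk adjacency x y p → Between (coord x) (coord y) t →
                     ∃[ z ] z ∈ p × toℕ z ≡ t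
  crossing-between {x} {y} t x≢y walk between with ≤-total (coord x) (coord y)
  ... | inj₁ x≤y = let l , u = Equivalence.to (between-≤ x≤y) between in crossing t walk l u (inj₂ x≢y)
  ... | inj₂ y≤x with walk-reverse adjacency-sym walk
  ...   | _ , back , r⊆ =
    let l , u       = Equivalence.to (between-≤ y≤x) (between-sym between)
        z , z∈ , z≡ = crossing t back l u (inj₂ (x≢y ∘ sym))
    in  z , r⊆ z∈ , z≡

  QuartetAt : Fin n → Fin n → Fin n → Fin n → Set
  QuartetAt a b c d = ∃[ p ] ∃[ q ] (Path adjacency (leaf-vertex a) (leaf-vertex b) p ×
                                     Path adjacency (leaf-vertex c) (leaf-vertex d) q × (∀ x → x ∈ p → ¬ x ∈ q))

  separated⇒quartet : ∀ {a b c d} → Separated (toℕ a) (toℕ b) (toℕ c) (toℕ d) → QuartetAt a b c d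
  separated⇒quartet {a} {b} {c} {d} sep
    with walk-between (leaf-vertex a) (leaf-vertex b) | walk-between (leaf-vertex c) (leaf-vertex d)
  ... | _ , walk₁ , in₁ | _ , walk₂ , in₂ with walk⇒path walk₁ | walk⇒path walk₂
  ... | p , path₁ , p⊆ | q , path₂ , q⊆ = p , q , path₁ , path₂ , λ x x∈p x∈q → separated-disjoint sep
    (subst₂ (λ u v → Between u v (coord x)) (coord-leaf-vertex a) (coord-leaf-vertex b) (All.lookup in₁ (p⊆ x∈p)))
    (subst₂ (λ u v → Between u v (coord x)) (coord-leaf-vertex c) (coord-leaf-vertex d) (All.lookup in₂ (q⊆ x∈q)))

  quartet⇒separated : ∀ {a b c d} → a ≢ b → c ≢ d → QuartetAt a b c d → Separated (toℕ a) (toℕ b) (toℕ c) (toℕ d)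
  quartet⇒separated {a} {b} {c} {d} a≢b c≢d (p , q , (walk₁ , _) , (walk₂ , _) , disjoint)
    with separated? (toℕ a) (toℕ b) (toℕ c) (toℕ d)
  ... | yes sep = sep
  ... | no ¬sep with not-separated-meet _ _ _ _ ¬sep
  ...   | t , meet₁ , meet₂
    with crossing-between t (a≢b ∘ leaf-vertex-injective) walk₁
           (subst₂ (λ u v → Between u v t) (sym (coord-leaf-vertex a)) (sym (coord-leaf-vertex b)) meet₁)
       | crossing-between t (c≢d ∘ leaf-vertex-injective) walk₂
           (subst₂ (λ u v → Between u v t) (sym (coord-leaf-vertex c)) (sym (coord-leaf-vertex d)) meet₂)
  ...     | z₁ , z₁∈p , z₁≡ | z₂ , z₂∈q , z₂≡ with toℕ-injective (trans z₁≡ (sym z₂≡))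
  ...       | refl = ⊥-elim (disjoint z₁ z₁∈p z₂∈q)

  quartet⇔separated : ∀ {a b c d} → a ≢ b → c ≢ d → QuartetAt a b c d ⇔ Separated (toℕ a) (toℕ b) (toℕ c) (toℕ d)
  quartet⇔separated a≢b c≢d = mk⇔ (quartet⇒separated a≢b c≢d) separated⇒quartet

  neighbours-of-0 : ∀ j → Edge 0 j ⇔ j ∈ 1 ∷ []
  neighbours-of-0 j = mk⇔ to λ { (here refl) → inj₁ (spine refl z≤n) }
    where
    to : Edge 0 j → j ∈ 1 ∷ []
    to (inj₁ (spine e _))      = here e
    to (inj₁ (pendant _ () _))
    to (inj₂ (spine () _))
    to (inj₂ (pendant () _ _))

  neighbours-of-end : ∀ j → Edge (suc S) j ⇔ j ∈ S ∷ []
  neighbours-of-end j = mk⇔ to λ { (here refl) → inj₂ (spine refl ≤-refl) }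
    where
    to : Edge (suc S) j → j ∈ S ∷ []
    to (inj₁ (spine _ S+1≤S))       = ⊥-elim (1+n≰n S+1≤S)
    to (inj₁ (pendant _ _ S+1≤S))   = ⊥-elim (1+n≰n S+1≤S)
    to (inj₂ (spine e _))           = here (sym (suc-injective e))
    to (inj₂ (pendant e 1≤j _))     = ⊥-elim (<⇒≢ (m<m+n (suc S) 1≤j) e)

  neighbours-of-pendant : ∀ {i} → 1 ≤ i → i ≤ S → ∀ j → Edge (suc S + i) j ⇔ j ∈ i ∷ []
  neighbours-of-pendant {i} 1≤i i≤S j = mk⇔ to λ { (here refl) → inj₂ (pendant refl 1≤i i≤S) }
    where
    to : Edge (suc S + i) j → j ∈ i ∷ []
    to (inj₁ (spine _ ≤S))     = ⊥-elim (<⇒≱ (m<m+n (suc S) 1≤i) (m≤n⇒m≤1+n ≤S))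
    to (inj₁ (pendant _ _ ≤S)) = ⊥-elim (<⇒≱ (m<m+n (suc S) 1≤i) (m≤n⇒m≤1+n ≤S))
    to (inj₂ (spine e j≤S))    = ⊥-elim (<⇒≱ (≤-<-trans j≤S (m<m+n S 1≤i)) (≤-reflexive (suc-injective e)))
    to (inj₂ (pendant e _ _))  = here (sym (+-cancelˡ-≡ (suc S) _ _ e))

  neighbours-of-inner : ∀ {t} → t < S → ∀ j → Edge (suc t) j ⇔ j ∈ suc (suc t) ∷ t ∷ suc S + suc t ∷ []
  neighbours-of-inner {t} t<S j = mk⇔ to from
    where
    to : Edge (suc t) j → j ∈ suc (suc t) ∷ t ∷ suc S + suc t ∷ []
    to (inj₁ (spine e _))      = here e
    to (inj₁ (pendant e _ _))  = there (there (here e))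
    to (inj₂ (spine e _))      = there (here (sym (suc-injective e)))
    to (inj₂ (pendant e _ _))  = ⊥-elim (<⇒≱ t<S (≤-trans (m≤m+n S _) (≤-reflexive (suc-injective (sym e)))))
    from : j ∈ suc (suc t) ∷ t ∷ suc S + suc t ∷ [] → Edge (suc t) j
    from (here refl)                 = inj₁ (spine refl t<S)
    from (there (here refl))         = inj₂ (spine refl (<⇒≤ t<S))
    from (there (there (here refl))) = inj₁ (pendant refl (s≤s z≤n) t<S)

  adjacent⇔ : ∀ {x y k ns} → toℕ x ≡ k → (∀ j → Edge k j ⇔ j ∈ ns) → adjacency x y ≡ true ⇔ toℕ y ∈ ns
  adjacent⇔ {x} {y} refl neighbours =
    mk⇔ (Equivalence.to (neighbours (toℕ y)) ∘ edge-of) (dec-true (edge? (toℕ x) (toℕ y)) ∘ Equivalence.from (neighbours (toℕ y)))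

  degree-from-neighbours : ∀ v {k ns} → toℕ v ≡ k → (∀ j → Edge k j ⇔ j ∈ ns) → Unique ns → All (_< NV) ns →
                           degree adjacency v ≡ length ns
  degree-from-neighbours v {k} {ns} refl neighbours !ns ns<NV =
    degree≡length (λ a b → does (edge? a b)) v (λ j → does-⇔ (neighbours j) (edge? k j) (j ∈? ns)) !ns ns<NV

  data SpineIndex : ℕ → Set where
    first : SpineIndex 0
    inner : ∀ {t} → t < S → SpineIndex (suc t)
    last  : SpineIndex (suc S)

  spine-index : ∀ {k} → k ≤ suc S → SpineIndex k
  spine-index {zero}  _   = first
  spine-index {suc t} k≤ with suc t ≤? S
  ... | yes t<S = inner t<S
  ... | no  t≮S = subst SpineIndex (≤-antisym (≰⇒> t≮S) k≤) last

  position : ∀ {t} → t ≤ suc S → Fin n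
  position t≤ = fromℕ< (s≤s t≤)

  leaf-at : ∀ {v t} (t≤ : t ≤ suc S) → toℕ v ≡ leafℕ t → leaf-vertex (position t≤) ≡ v
  leaf-at t≤ v≡ = toℕ-injective (trans (leaf-vertex-at (toℕ-fromℕ< (s≤s t≤))) (sym v≡))

  leaf-degree : ∀ {v k} → toℕ v ≡ leafℕ k → SpineIndex k → degree adjacency v ≡ 1
  leaf-degree {v} v≡ first =
    degree-from-neighbours v v≡ neighbours-of-0 ([] ∷ []) (s≤s (s≤s z≤n) ∷ [])
  leaf-degree {v} v≡ (inner t<S) =
    degree-from-neighbours v (trans v≡ (leafℕ-pendant (s≤s z≤n) t<S)) (neighbours-of-pendant (s≤s z≤n) t<S)
                           ([] ∷ []) (spine<NV (m≤n⇒m≤1+n t<S) ∷ [])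
  leaf-degree {v} v≡ last =
    degree-from-neighbours v (trans v≡ leafℕ-last) neighbours-of-end ([] ∷ []) (spine<NV (n≤1+n S) ∷ [])

  spine-degree : ∀ {v k} → (∀ p → leaf-vertex p ≢ v) → toℕ v ≡ k → SpineIndex k → degree adjacency v ≡ 3
  spine-degree not-leaf v≡ first   = ⊥-elim (not-leaf (position z≤n) (leaf-at z≤n v≡))
  spine-degree not-leaf v≡ last    = ⊥-elim (not-leaf (position ≤-refl) (leaf-at ≤-refl (trans v≡ (sym leafℕ-last))))
  spine-degree {v} {suc t} not-leaf v≡ (inner t<S) = degree-from-neighbours v v≡ (neighbours-of-inner t<S)
    ((<⇒≢ (m<n⇒m<1+n (n<1+n t)) ∘ sym ∷ <⇒≢ (s≤s (m<n+m (suc t) (≤-<-trans z≤n t<S))) ∷ []) ∷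
     (<⇒≢ (m≤n+m (suc t) (suc S)) ∷ []) ∷ [] ∷ [])
    (spine<NV (s≤s t<S) ∷ spine<NV (≤-trans (n≤1+n t) (m≤n⇒m≤1+n t<S)) ∷ s≤s (+-monoʳ-≤ (suc S) t<S) ∷ [])

  inner-degree : ∀ v → (∀ p → leaf-vertex p ≢ v) → degree adjacency v ≡ 3
  inner-degree v not-leaf with on-spine? v
  ... | yes sv = spine-degree not-leaf refl (spine-index (subst (_≤ suc S) sv (coordℕ≤ (toℕ<n v))))
  ... | no ¬sv with pendant-index (toℕ<n v) ¬sv
  ...   | v≡ , 1≤ , ≤S =
    ⊥-elim (not-leaf (position (m≤n⇒m≤1+n ≤S)) (leaf-at (m≤n⇒m≤1+n ≤S) (trans v≡ (sym (leafℕ-pendant 1≤ ≤S)))))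

  caterpillar : Permutation′ n → PhyloTree n
  caterpillar σ = record
    { V          = NV
    ; adj        = adjacency
    ; adj-sym    = adjacency-sym
    ; adj-irr    = adjacency-irr
    ; connected  = caterpillar-connected
    ; uniquePath = separated⇒unique-paths neighbours-separated
    ; leaf       = leaf-vertex ∘ (σ ⟨$⟩ʳ_)
    ; leaf-inj   = λ _ _ → permutation-injective σ ∘ leaf-vertex-injective
    ; leaf-deg   = λ i → leaf-degree (toℕ-leaf-vertex (σ ⟨$⟩ʳ i)) (spine-index (position≤ (σ ⟨$⟩ʳ i)))
    ; inner-deg  = λ v not-leaf → inner-degree v λ p → not-leaf (σ ⟨$⟩ˡ p) ∘ trans (cong leaf-vertex (inverseʳ σ))
    }

  cherry-01 : 1 ≤ S → ∀ {p q} → toℕ p ≡ 0 → toℕ q ≡ 1 →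
              ∃[ v ] adjacency (leaf-vertex p) v ≡ true × adjacency (leaf-vertex q) v ≡ true
  cherry-01 1≤S p≡0 q≡1 =
    v , Equivalence.from (adjacent⇔ {y = v} (leaf-vertex-at p≡0) neighbours-of-0) (here v≡1)
      , Equivalence.from (adjacent⇔ {y = v} (trans (leaf-vertex-at q≡1) (leafℕ-pendant ≤-refl 1≤S))
                                              (neighbours-of-pendant ≤-refl 1≤S)) (here v≡1)
    where
    v : Fin NV
    v = fromℕ< (spine<NV (s≤s z≤n))
    v≡1 : toℕ v ≡ 1
    v≡1 = toℕ-fromℕ< (spine<NV (s≤s z≤n))

  no-cherry-02 : 2 ≤ S → ∀ {p q} → toℕ p ≡ 0 → toℕ q ≡ 2 →
                 ∀ v → adjacency (leaf-vertex p) v ≡ true → adjacency (leaf-vertex q) v ≡ true → ⊥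
  no-cherry-02 2≤S p≡0 q≡2 v e₁ e₂
    with Equivalence.to (adjacent⇔ {y = v} (leaf-vertex-at p≡0) neighbours-of-0) e₁
       | Equivalence.to (adjacent⇔ {y = v} (trans (leaf-vertex-at q≡2) (leafℕ-pendant (s≤s z≤n) 2≤S))
                                            (neighbours-of-pendant (s≤s z≤n) 2≤S)) e₂
  ... | here v≡1 | here v≡2 = 1+n≢n (trans (sym v≡2) v≡1)

module LowerBound where

  open import Data.Nat using (zero; z≤n; s≤s)
  open import Data.Nat.Properties using (*-monoʳ-≤; *-assoc; module ≤-Reasoning)
  open import Data.Nat.Combinatorics using (_C_)
  open import Data.Bool using (true)
  open import Data.Fin using (zero; suc; toℕ)
  open import Data.Fin.Properties using (toℕ-injective)
  open import Data.Fin.Subset using () renaming (_∈_ to _∈ₛ_)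
  open import Data.Fin.Subset.Properties using (_∈?_)
  open import Data.Fin.Permutation using (_⟨$⟩ʳ_; _⟨$⟩ˡ_; inverseʳ; _∘ₚ_)
  open import Data.Vec using ([]; _∷_)
  open import Data.Vec.Relation.Unary.All using ([]; _∷_; all?)
  open import Data.Vec.Relation.Unary.AllPairs using ([]; _∷_)
  open import Data.List using ([]; _∷_; map)
  open import Data.List.Membership.Propositional using (_∈_; lose)
  open import Data.List.Membership.Propositional.Properties using (∈-map⁻)
  open import Data.List.Relation.Unary.Any using (here; there; any?)
  open import Data.Empty using (⊥-elim)
  open import Function using (_∘_; _⇔_; Inverse)
  import Function.Properties.Equivalence as ⇔
  open import Relation.Binary.PropositionalEquality using (_≡_; _≢_; refl; sym; trans; cong; subst)
  open import Relation.Nullary using (¬_; yes; no)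
  open Binomial
  open Covering
  open Separation using (swap₁₂; Avoids012; Separated; separated⇔swap)
  open Permutations

  Cherry : ∀ {n} → PhyloTree n → Fin n → Fin n → Set
  Cherry T i j = ∃[ v ] adj T (leaf T i) v ≡ true × adj T (leaf T j) v ≡ true

  ≅-preserves-cherry : ∀ {n} {T₁ T₂ : PhyloTree n} {i j} → T₁ ≅ T₂ → Cherry T₁ i j → Cherry T₂ i j
  ≅-preserves-cherry {T₁ = T₁} {T₂} {i} {j} (f , adj≡ , leaf≡) (v , e₁ , e₂) =
    Inverse.to f v , moved i e₁ , moved j e₂
    where
    moved : ∀ k → adj T₁ (leaf T₁ k) v ≡ true → adj T₂ (leaf T₂ k) (Inverse.to f v) ≡ true
    moved k e = subst (λ x → adj T₂ x (Inverse.to f v) ≡ true) (leaf≡ k) (trans (sym (adj≡ (leaf T₁ k) v)) e)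

  module FourOrMoreLeaves (m : ℕ) where

    open Caterpillar (suc (suc m))

    -- The leaves σ⁻¹ 0 and σ⁻¹ 1 form a cherry in the first tree but sit at positions 0 and 2 in the second.
    caterpillars-differ : ∀ σ → ¬ caterpillar σ ≅ caterpillar (σ ∘ₚ τ)
    caterpillars-differ σ iso
      with ≅-preserves-cherry {T₁ = caterpillar σ} {caterpillar (σ ∘ₚ τ)} {σ ⟨$⟩ˡ zero} {σ ⟨$⟩ˡ suc zero} iso
             (cherry-01 (s≤s z≤n) (cong toℕ (inverseʳ σ)) (cong toℕ (inverseʳ σ)))
    ... | v , e₁ , e₂ =
      no-cherry-02 (s≤s (s≤s z≤n)) (cong (toℕ ∘ swap₁₂ᶠ) (inverseʳ σ)) (cong (toℕ ∘ swap₁₂ᶠ) (inverseʳ σ)) v e₁ e₂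

    quartet-after-swap : ∀ {a b c d} → a ≢ b → c ≢ d →
                         QuartetAt (swap₁₂ᶠ a) (swap₁₂ᶠ b) (swap₁₂ᶠ c) (swap₁₂ᶠ d) ⇔
                         Separated (swap₁₂ (toℕ a)) (swap₁₂ (toℕ b)) (swap₁₂ (toℕ c)) (swap₁₂ (toℕ d))
    quartet-after-swap {a} {b} {c} {d} a≢b c≢d
      rewrite sym (toℕ-swap₁₂ᶠ a) | sym (toℕ-swap₁₂ᶠ b) | sym (toℕ-swap₁₂ᶠ c) | sym (toℕ-swap₁₂ᶠ d) =
      quartet⇔separated (a≢b ∘ permutation-injective τ) (c≢d ∘ permutation-injective τ)

    avoids-012 : ∀ σ {a b c} {q : Subset n} (us : List (Fin n)) →
                 σ ⟨$⟩ʳ a ≡ zero → σ ⟨$⟩ʳ b ≡ suc zero → σ ⟨$⟩ʳ c ≡ suc (suc zero) →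
                 ¬ (a ∈ₛ q × b ∈ₛ q × c ∈ₛ q) → (∀ {u} → u ∈ us → u ∈ₛ q) → Avoids012 (map (toℕ ∘ (σ ⟨$⟩ʳ_)) us)
    avoids-012 σ us σa σb σc abc⊈q us⊆q 0∈ 1∈ 2∈ =
      abc⊈q (us⊆q (preimage σa 0∈) , us⊆q (preimage σb 1∈) , us⊆q (preimage σc 2∈))
      where
      preimage : ∀ {a t} → σ ⟨$⟩ʳ a ≡ t → toℕ t ∈ map (toℕ ∘ (σ ⟨$⟩ʳ_)) us → a ∈ us
      preimage σa≡t t∈ with ∈-map⁻ (toℕ ∘ (σ ⟨$⟩ʳ_)) t∈
      ... | u , u∈ , t≡ = subst (_∈ us) (sym (permutation-injective σ (toℕ-injective (trans (cong toℕ σa≡t) t≡)))) u∈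

    same-answers : ∀ σ {a b c} {q : Subset n} → σ ⟨$⟩ʳ a ≡ zero → σ ⟨$⟩ʳ b ≡ suc zero → σ ⟨$⟩ʳ c ≡ suc (suc zero) →
                   ¬ (a ∈ₛ q × b ∈ₛ q × c ∈ₛ q) → SameAnswer (caterpillar σ) (caterpillar (σ ∘ₚ τ)) q
    same-answers σ σa σb σc abc⊈q x y z w x∈ y∈ z∈ w∈ x≢y _ _ _ _ z≢w =
      ⇔.trans (quartet⇔separated σx≢σy σz≢σw)
     (⇔.trans (separated⇔swap (σx≢σy ∘ toℕ-injective) (σz≢σw ∘ toℕ-injective) avoids)
              (⇔.sym (quartet-after-swap σx≢σy σz≢σw)))
      where
      σx≢σy : σ ⟨$⟩ʳ x ≢ σ ⟨$⟩ʳ y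
      σx≢σy = x≢y ∘ permutation-injective σ
      σz≢σw : σ ⟨$⟩ʳ z ≢ σ ⟨$⟩ʳ w
      σz≢σw = z≢w ∘ permutation-injective σ
      quartet⊆q : ∀ {u} → u ∈ x ∷ y ∷ z ∷ w ∷ [] → u ∈ₛ _
      quartet⊆q (here refl)                         = x∈
      quartet⊆q (there (here refl))                 = y∈
      quartet⊆q (there (there (here refl)))         = z∈
      quartet⊆q (there (there (there (here refl)))) = w∈
      avoids : Avoids012 (map (toℕ ∘ (σ ⟨$⟩ʳ_)) (x ∷ y ∷ z ∷ w ∷ []))
      avoids = avoids-012 σ (x ∷ y ∷ z ∷ w ∷ []) σa σb σc abc⊈q quartet⊆q

    triples-covered : ∀ {Q} → Reconstructs Q → Covers 3 Q
    triples-covered {Q} reconstructs (a ∷ b ∷ c ∷ []) ((a≢b ∷ a≢c ∷ []) ∷ (b≢c ∷ []) ∷ [] ∷ [])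
      with any? (λ q → all? (_∈? q) (a ∷ b ∷ c ∷ [])) Q
    ... | yes covered = covered
    ... | no ¬covered with placing-012 a≢b a≢c b≢c
    ...   | σ , σa , σb , σc = ⊥-elim (caterpillars-differ σ (reconstructs (caterpillar σ) (caterpillar (σ ∘ₚ τ))
      λ q q∈Q → same-answers σ σa σb σc λ (a∈ , b∈ , c∈) → ¬covered (lose q∈Q (a∈ ∷ b∈ ∷ c∈ ∷ []))))

  cubic-bound : ∀ {n} → 6 ≤ n → (Q : List (Subset n)) → ValidQueries Q → Reconstructs Q → n ^ 3 ≤ 48 * length Q
  cubic-bound {n} 6≤n@(s≤s (s≤s (s≤s (s≤s (s≤s (s≤s {n = m} _)))))) Q (_ , quadruples) reconstructs = begin
    n ^ 3                ≤⟨ n³≤12*nC3 6≤n ⟩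
    12 * (n C 3)         ≤⟨ *-monoʳ-≤ 12 (covering-bound n 3 Q triples-covered) ⟩
    12 * weight 3 Q      ≡⟨ cong (12 *_) (weight-of-quadruples Q quadruples) ⟩
    12 * (4 * length Q)  ≡⟨ sym (*-assoc 12 4 (length Q)) ⟩
    48 * length Q        ∎
    where
    open ≤-Reasoning
    triples-covered : Covers 3 Q
    triples-covered = FourOrMoreLeaves.triples-covered (suc (suc m)) reconstructs

lemma16 : ∃[ k ] ∃[ N ] ∀ (n : ℕ) → N ≤ n → (Q : List (Subset n)) →
    ValidQueries Q → Reconstructs Q → n ^ 3 ≤ suc k * length Q
lemma16 = 47 , 6 , λ n → LowerBound.cubic-bound
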